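{- The formula $\square(p\vee q)\rightarrow((\lozenge p\rightarrow\square q)\rightarrow\square q)$ belongs to $\mathbf{LIK4}$.
   Context: Let $\mathbf{At}$ be a countably infinite set of atoms, $p,q\in\mathbf{At}$. Formulas are given by $A::=p\mid (A\rightarrow A)\mid \top\mid\bot\mid (A\wedge A)\mid (A\vee A)\mid \square A\mid \lozenge A$; $\neg A$ abbreviates $A\rightarrow\bot$. $\mathbf{LIK4}$ is the least set of formulas that is closed under uniform substitution, contains the standard axioms of intuitionistic propositional logic, is closed under the standard inference rules of intuitionistic propositional logic (modus ponens), contains the axioms $\square p\wedge\square q\rightarrow\square(p\wedge q)$, $\lozenge(p\vee q)\rightarrow\lozenge p\vee\lozenge q$, $\square\top$, $\neg\lozenge\bot$, $\square p\rightarrow\square\square p$, $\lozenge\lozenge p\rightarrow\lozenge p$, $\square(p\vee q)\rightarrow\lozenge p\vee\square q$, $\lozenge(p\rightarrow q)\rightarrow(\square p\rightarrow\lozenge q)$, and is closed under the rules: from $p\rightarrow q$ infer $\square p\rightarrow\square q$; from $p\rightarrow q$ infer $\lozenge p\rightarrow\lozenge q$. -}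

module Defs where

open import Data.Nat using (ℕ)

At : Set
At = ℕ

infixr 5 _⇒_
infixr 6 _∨′_
infixr 7 _∧′_

data Fm : Set where
  atom : At → Fm
  _⇒_  : Fm → Fm → Fm
  ⊤′   : Fm
  ⊥′   : Fm
  _∧′_ : Fm → Fm → Fm
  _∨′_ : Fm → Fm → Fm
  □    : Fm → Fm
  ◇    : Fm → Fm

¬′ : Fm → Fm
¬′ A = A ⇒ ⊥′

subst : (At → Fm) → Fm → Fm
subst σ (atom x) = σ x
subst σ (A ⇒ B)  = subst σ A ⇒ subst σ B
subst σ ⊤′       = ⊤′
subst σ ⊥′       = ⊥′
subst σ (A ∧′ B) = subst σ A ∧′ subst σ B
subst σ (A ∨′ B) = subst σ A ∨′ subst σ B
subst σ (□ A)    = □ (subst σ A)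
subst σ (◇ A)    = ◇ (subst σ A)

p q r : Fm
p = atom 0
q = atom 1
r = atom 2

data LIK4 : Fm → Set where
  ax-K     : LIK4 (p ⇒ (q ⇒ p))
  ax-S     : LIK4 ((p ⇒ (q ⇒ r)) ⇒ ((p ⇒ q) ⇒ (p ⇒ r)))
  ax-∧E₁   : LIK4 (p ∧′ q ⇒ p)
  ax-∧E₂   : LIK4 (p ∧′ q ⇒ q)
  ax-∧I    : LIK4 (p ⇒ (q ⇒ p ∧′ q))
  ax-∨I₁   : LIK4 (p ⇒ p ∨′ q)
  ax-∨I₂   : LIK4 (q ⇒ p ∨′ q)
  ax-∨E    : LIK4 ((p ⇒ r) ⇒ ((q ⇒ r) ⇒ (p ∨′ q ⇒ r)))
  ax-⊥E    : LIK4 (⊥′ ⇒ p)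
  ax-⊤     : LIK4 ⊤′
  ax-□∧    : LIK4 (□ p ∧′ □ q ⇒ □ (p ∧′ q))
  ax-◇∨    : LIK4 (◇ (p ∨′ q) ⇒ ◇ p ∨′ ◇ q)
  ax-□⊤    : LIK4 (□ ⊤′)
  ax-¬◇⊥   : LIK4 (¬′ (◇ ⊥′))
  ax-4□    : LIK4 (□ p ⇒ □ (□ p))
  ax-4◇    : LIK4 (◇ (◇ p) ⇒ ◇ p)
  ax-□∨    : LIK4 (□ (p ∨′ q) ⇒ ◇ p ∨′ □ q)
  ax-◇⇒    : LIK4 (◇ (p ⇒ q) ⇒ (□ p ⇒ ◇ q))
  usubst   : ∀ (σ : At → Fm) {A} → LIK4 A → LIK4 (subst σ A)
  mp       : ∀ {A B} → LIK4 (A ⇒ B) → LIK4 A → LIK4 B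
  mono-□   : ∀ {A B} → LIK4 (A ⇒ B) → LIK4 (□ A ⇒ □ B)
  mono-◇   : ∀ {A B} → LIK4 (A ⇒ B) → LIK4 (◇ A ⇒ ◇ B)

-- The axiom □(p ∨ q) → ◇p ∨ □q reduces the claim to the propositional
-- tautology X ∨ Y → ((X → Y) → Y) with X = ◇p and Y = □q: the left
-- disjunct yields Y through the hypothesis X → Y, the right one directly.
module Submission where

open import Data.Nat using (suc)
open import Defs

substPQR : Fm → Fm → Fm → At → Fm
substPQR A B C 0             = A
substPQR A B C 1             = B
substPQR A B C (suc (suc _)) = C

⇒-const : ∀ A B → LIK4 (A ⇒ (B ⇒ A))
⇒-const A B = usubst (substPQR A B ⊤′) ax-K

⇒-distrib : ∀ A B C → LIK4 ((A ⇒ (B ⇒ C)) ⇒ ((A ⇒ B) ⇒ (A ⇒ C)))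
⇒-distrib A B C = usubst (substPQR A B C) ax-S

∨-elim : ∀ A B C → LIK4 ((A ⇒ C) ⇒ ((B ⇒ C) ⇒ (A ∨′ B ⇒ C)))
∨-elim A B C = usubst (substPQR A B C) ax-∨E

⇒-refl : ∀ A → LIK4 (A ⇒ A)
⇒-refl A = mp (mp (⇒-distrib A (A ⇒ A) A) (⇒-const A (A ⇒ A))) (⇒-const A A)

⇒-trans : ∀ {A B C} → LIK4 (A ⇒ B) → LIK4 (B ⇒ C) → LIK4 (A ⇒ C)
⇒-trans {A} {B} {C} A⇒B B⇒C =
  mp (mp (⇒-distrib A B C) (mp (⇒-const (B ⇒ C) A) B⇒C)) A⇒B

⇒-eval : ∀ A B → LIK4 (A ⇒ ((A ⇒ B) ⇒ B))
⇒-eval A B = ⇒-trans (⇒-const A (A ⇒ B)) (mp (⇒-distrib (A ⇒ B) A B) (⇒-refl (A ⇒ B)))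

∨-⇒-collapse : ∀ A B → LIK4 (A ∨′ B ⇒ ((A ⇒ B) ⇒ B))
∨-⇒-collapse A B = mp (mp (∨-elim A B ((A ⇒ B) ⇒ B)) (⇒-eval A B)) (⇒-const B (A ⇒ B))

lemma14 : LIK4 (□ (p ∨′ q) ⇒ ((◇ p ⇒ □ q) ⇒ □ q))
lemma14 = ⇒-trans ax-□∨ (∨-⇒-collapse (◇ p) (□ q))
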